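{- Let $k$ be a positive integer, let $H$ be a subgraph of a $k$-tree, and let $G$ be an $H$-free graph. \begin{enumerate} \item There exist a constant $C=C(H)$ and a map $f:\mathcal{K}_{k+1}(G)\to\mathcal{K}_k(G)$ such that for each $U\in\mathcal{K}_{k+1}(G)$, $f(U)$ is a $k$-clique contained in $U$, and for each $W\in\mathcal{K}_k(G)$, $|f^{ -1}(W)|\le C$. \item $\mathrm{ex}(n,K_{k+1},H)=O(\mathrm{ex}(n,K_k,H))$. \end{enumerate}
   Context: All graphs are finite and simple. $\mathcal{K}_j(G)$ denotes the set of $j$-cliques (complete subgraphs on $j$ vertices) of $G$. A $k$-tree is defined recursively: $K_k$ is a $k$-tree; if $T$ is a $k$-tree, then the graph obtained from $T$ by adding a new vertex joined to all vertices of some $k$-clique of $T$ is a $k$-tree; there are no other $k$-trees. $\mathrm{ex}(n,T,F)$ is the maximum number of copies of $T$ in an $n$-vertex graph with no subgraph isomorphic to $F$. -}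

module Defs where

open import Data.Nat using (ℕ; zero; suc; _≤_; _≟_)
open import Data.Bool using (Bool; true; false)
import Data.Bool.Properties as BoolP
open import Data.Fin using (Fin; inject₁; fromℕ)
import Data.Fin.Properties as FinP
open import Data.Fin.Subset using (Subset; _∈_; ∣_∣; inside; outside)
open import Data.Fin.Subset.Properties using (_∈?_)
open import Data.Vec using (Vec; []; _∷_; tabulate; map)
open import Data.List using (List; []; _∷_; _++_; length; filter)
import Data.List as L
open import Data.Product using (Σ; Σ-syntax; ∃; _×_; _,_)
open import Relation.Nullary using (¬_; Dec; yes; no; ¬?)
open import Relation.Nullary.Decidable using (_×-dec_; _→-dec_)
open import Relation.Binary.PropositionalEquality using (_≡_; _≢_)
open import Function.Definitions using (Injective)

record Graph (n : ℕ) : Set where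
  field
    adj    : Fin n → Fin n → Bool
    sym    : ∀ i j → adj i j ≡ adj j i
    irrefl : ∀ i → adj i i ≡ false
open Graph public

IsClique : ∀ {n} → Graph n → ℕ → Subset n → Set
IsClique {n} G j s =
  ∣ s ∣ ≡ j × (∀ (x y : Fin n) → x ∈ s → y ∈ s → x ≢ y → adj G x y ≡ true)

isClique? : ∀ {n} (G : Graph n) (j : ℕ) (s : Subset n) → Dec (IsClique G j s)
isClique? G j s =
  (∣ s ∣ ≟ j) ×-dec
  FinP.all? (λ x → FinP.all? (λ y →
    (x ∈? s) →-dec ((y ∈? s) →-dec ((¬? (x FinP.≟ y)) →-dec (adj G x y BoolP.≟ true)))))

allSubsets : (n : ℕ) → List (Subset n)
allSubsets zero    = [] ∷ []
allSubsets (suc n) = L.map (inside ∷_) (allSubsets n) ++ L.map (outside ∷_) (allSubsets n)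

numCliques : ∀ {n} → Graph n → ℕ → ℕ
numCliques {n} G j = length (filter (isClique? G j) (allSubsets n))

Embeds : ∀ {m n} → Graph m → Graph n → Set
Embeds {m} {n} H G =
  Σ[ φ ∈ (Fin m → Fin n) ] (Injective _≡_ _≡_ φ ×
     (∀ i j → adj H i j ≡ true → adj G (φ i) (φ j) ≡ true))

Free : ∀ {m n} → Graph m → Graph n → Set
Free H G = ¬ Embeds H G

restrict : ∀ {n} → Graph (suc n) → Graph n
restrict G = record
  { adj    = λ i j → adj G (inject₁ i) (inject₁ j)
  ; sym    = λ i j → sym G (inject₁ i) (inject₁ j)
  ; irrefl = λ i → irrefl G (inject₁ i) }

lastNbhd : ∀ {n} → Graph (suc n) → Subset n
lastNbhd {n} G = tabulate (λ i → adj G (inject₁ i) (fromℕ n))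

-- k-trees, labelled so that vertices are numbered in order of insertion:
-- base: the complete graph K_k on Fin k;
-- step: the last vertex is joined to exactly the vertices of some k-clique
--       of the k-tree formed by the previous vertices.
-- Every k-tree is isomorphic to one of these, and conversely.
data IsKTree (k : ℕ) : ∀ {n} → Graph n → Set where
  base : (G : Graph k) → (∀ i j → i ≢ j → adj G i j ≡ true) → IsKTree k G
  step : ∀ {n} (G : Graph (suc n)) → IsKTree k (restrict G) →
         IsClique (restrict G) k (lastNbhd G) → IsKTree k G

SubgraphOfKTree : ∀ {m} → ℕ → Graph m → Set
SubgraphOfKTree k H = Σ[ n ∈ ℕ ] Σ[ T ∈ Graph n ] (IsKTree k T × Embeds H T)

IsEx : ∀ {m} → ℕ → ℕ → Graph m → ℕ → Set
IsEx n j H e =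
  (Σ[ G ∈ Graph n ] (Free H G × numCliques G j ≡ e)) ×
  (∀ (G : Graph n) → Free H G → numCliques G j ≤ e)

{-# OPTIONS --safe #-}
-- Fix a k-tree T ⊇ H on t vertices and let F be the family of (k+1)-cliques of G. Call a
-- k-subset W of a member of F a face, and v an extension of W if v ∉ W and W ∪ {v} ∈ F.
-- Peel F greedily: while some member U has a face W with fewer than t extensions, put
-- f U = W and delete U. The cliques sent to W all contain W and are still present when the
-- first of them is deleted, so every fibre of f has fewer than t elements. If the peeling
-- stopped at a nonempty family, every face would have at least t extensions and T would embed
-- into G vertex by vertex: the image of the neighbourhood of the next vertex of T lies in a
-- face, and that face has an extension not yet used. Counting the fibres of f then gives
-- ex(n, K_{k+1}, H) ≤ t · ex(n, K_k, H).

module Submission where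

open import Defs hiding (sym)
open import Data.Nat using (ℕ; zero; suc; _≤_; _<_; _*_; _+_; z≤n; s≤s⁻¹; _≤?_)
open import Data.Nat.Properties
  using (≤-refl; ≤-reflexive; ≤-trans; n≤1+n; <-≤-trans; suc-injective; <⇒≤; <⇒≱; ≮⇒≥;
         +-suc; *-suc; +-mono-≤; *-monoʳ-≤; module ≤-Reasoning)
  renaming (_≟_ to _≟ℕ_)
open import Data.Bool using (true; false)
import Data.Bool as Bool
open import Data.Fin using (Fin; zero; suc; inject₁; fromℕ)
import Data.Fin.Properties as Fin
open import Data.Fin.Relation.Unary.Top using (view; ‵fromℕ; ‵inject₁)
open import Data.Fin.Subset using (Subset; _∈_; _∉_; _⊆_; ∣_∣; _∪_; ⁅_⁆; _-_)
open import Data.Fin.Subset.Properties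
  using (_∈?_; _⊆?_; drop-there; drop-∷-⊆; p⊆q⇒∣p∣≤∣q∣; ∪-identityʳ; p─⊥≡p; p─q⊆p; p⊆p∪q; q⊆p∪q;
         x∈⁅x⁆; x∈p∧x≢y⇒x∈p-y)
open import Data.Vec using ([]; _∷_; lookup; tabulate; here; there)
open import Data.Vec.Properties using (≡-dec; lookup∘tabulate; []=⇒lookup; lookup⇒[]=; ∷-injectiveʳ)
open import Data.List using (List; []; _∷_; _++_; length; map; filter; allFin)
import Data.List as List
open import Data.List.Properties using (filter-notAll; length-map; length-tabulate)
open import Data.List.Relation.Unary.Any as Any using (Any; here; there)
open import Data.List.Relation.Unary.All as All using (All; []; _∷_)
import Data.List.Relation.Unary.All.Properties as All
open import Data.List.Relation.Unary.AllPairs using ([]; _∷_)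
open import Data.List.Relation.Unary.Unique.Propositional using (Unique)
import Data.List.Relation.Unary.Unique.Propositional.Properties as Unique
open import Data.List.Membership.Propositional using (find; lose) renaming (_∈_ to _∈ₗ_; _∉_ to _∉ₗ_)
open import Data.List.Membership.Propositional.Properties
  using (∈-filter⁺; ∈-filter⁻; ∈-allFin; ∈-map⁺; ∈-map⁻; ∈-tabulate⁺; ∈-++⁺ˡ; ∈-++⁺ʳ)
open import Data.List.Relation.Binary.Subset.Propositional using () renaming (_⊆_ to _⊆ₗ_)
open import Data.Product using (Σ-syntax; ∃-syntax; _×_; _,_; proj₁; proj₂)
open import Data.Sum using (_⊎_; inj₁; inj₂)
open import Function using (id; _∘_; case_of_)
open import Function.Definitions using (Injective)
open import Relation.Nullary using (¬_; Dec; yes; no; ¬?; contradiction)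
open import Relation.Nullary.Decidable using (decidable-stable; _×-dec_)
open import Relation.Unary.Properties using (∁?)
open import Relation.Binary.Definitions using (DecidableEquality)
open import Relation.Binary.PropositionalEquality using (_≡_; _≢_; refl; sym; trans; cong; subst)

private variable s n : ℕ

module _ {A : Set} (_≟_ : DecidableEquality A) where
  open import Data.List.Membership.DecPropositional _≟_ using () renaming (_∈?_ to _∈ₗ?_)

  Unique∧⊆⇒length≤ : ∀ {xs ys : List A} → Unique xs → xs ⊆ₗ ys → length xs ≤ length ys
  Unique∧⊆⇒length≤ {[]} _ _ = z≤n
  Unique∧⊆⇒length≤ {x ∷ xs} {ys} (x∉xs ∷ xs!) x∷xs⊆ys = begin-strict
    length xs                        ≤⟨ Unique∧⊆⇒length≤ xs! xs⊆ys-x ⟩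
    length (filter (¬? ∘ (x ≟_)) ys) <⟨ filter-notAll _ ys (Any.map (λ x≡y x≢y → x≢y x≡y) x∈ys) ⟩
    length ys                        ∎
    where
    open ≤-Reasoning
    x∈ys = x∷xs⊆ys (here refl)
    xs⊆ys-x : xs ⊆ₗ filter (¬? ∘ (x ≟_)) ys
    xs⊆ys-x y∈xs = ∈-filter⁺ _ (x∷xs⊆ys (there y∈xs)) (All.lookup x∉xs y∈xs)

  Unique∧longer⇒∃∉ : ∀ {xs ys : List A} → Unique xs → length ys < length xs →
    ∃[ x ] (x ∈ₗ xs × x ∉ₗ ys)
  Unique∧longer⇒∃∉ {xs} {ys} xs! ys<xs with Any.any? (λ x → ¬? (x ∈ₗ? ys)) xs
  ... | yes some = find some
  ... | no none  = contradiction (Unique∧⊆⇒length≤ xs! xs⊆ys) (<⇒≱ ys<xs)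
    where
    xs⊆ys : xs ⊆ₗ ys
    xs⊆ys {x} x∈xs = decidable-stable (x ∈ₗ? ys) (none ∘ lose x∈xs)

module FunctionUpdate {A : Set} (_≟_ : DecidableEquality A) {B : Set} where

  _[_↦_] : (A → B) → A → B → A → B
  (f [ x ↦ y ]) x′ with x ≟ x′
  ... | yes _ = y
  ... | no _  = f x′

  [↦]-updated : (f : A → B) (x : A) (y : B) → (f [ x ↦ y ]) x ≡ y
  [↦]-updated f x y with x ≟ x
  ... | yes _  = refl
  ... | no x≢x = contradiction refl x≢x

  [↦]-unchanged : (f : A → B) {x x′ : A} (y : B) → x ≢ x′ → (f [ x ↦ y ]) x′ ≡ f x′
  [↦]-unchanged f {x} {x′} y x≢x′ with x ≟ x′
  ... | yes x≡x′ = contradiction x≡x′ x≢x′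
  ... | no _     = refl

module _ {A B : Set} (_≟_ : DecidableEquality B) (g : A → B) where

  length-filter+length-filter-∁ : ∀ y (xs : List A) →
    length (filter (λ x → g x ≟ y) xs) + length (filter (∁? (λ x → g x ≟ y)) xs) ≡ length xs
  length-filter+length-filter-∁ y [] = refl
  length-filter+length-filter-∁ y (x ∷ xs) with g x ≟ y
  ... | yes _ = cong suc (length-filter+length-filter-∁ y xs)
  ... | no _  = trans (+-suc _ _) (cong suc (length-filter+length-filter-∁ y xs))

  FibresBoundedBy : ℕ → List A → Set
  FibresBoundedBy c xs = ∀ y zs → Unique zs → zs ⊆ₗ xs → All (λ z → g z ≡ y) zs → length zs ≤ c

  length≤fibreBound*length : ∀ c ys {xs} → Unique xs → All (λ x → g x ∈ₗ ys) xs →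
    FibresBoundedBy c xs → length xs ≤ c * length ys
  length≤fibreBound*length c [] {[]} _ _ _ = z≤n
  length≤fibreBound*length c [] {_ ∷ _} _ (() ∷ _) _
  length≤fibreBound*length c (y ∷ ys) {xs} xs! g[xs]⊆y∷ys fibres = begin
    length xs                                      ≡⟨ sym (length-filter+length-filter-∁ y xs) ⟩
    length (filter P? xs) + length (filter ¬P? xs) ≤⟨ +-mono-≤ fibre-y rest ⟩
    c + c * length ys                              ≡⟨ sym (*-suc c (length ys)) ⟩
    c * length (y ∷ ys)                            ∎
    where
    open ≤-Reasoning
    P? = λ x → g x ≟ y
    ¬P? = ∁? P?
    fibre-y : length (filter P? xs) ≤ c
    fibre-y = fibres y _ (Unique.filter⁺ P? xs!) (proj₁ ∘ ∈-filter⁻ P? {xs = xs})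
      (All.tabulate (proj₂ ∘ ∈-filter⁻ P? {xs = xs}))
    g[rest]⊆ys : All (λ x → g x ∈ₗ ys) (filter ¬P? xs)
    g[rest]⊆ys = All.tabulate λ x∈ → let x∈xs , gx≢y = ∈-filter⁻ ¬P? {xs = xs} x∈ in
      case All.lookup g[xs]⊆y∷ys x∈xs of λ where
        (here gx≡y) → contradiction gx≡y gx≢y
        (there gx∈ys) → gx∈ys
    rest : length (filter ¬P? xs) ≤ c * length ys
    rest = length≤fibreBound*length c ys (Unique.filter⁺ ¬P? xs!) g[rest]⊆ys
      λ y′ zs zs! zs⊆ → fibres y′ zs zs! (proj₁ ∘ ∈-filter⁻ ¬P? {xs = xs} ∘ zs⊆)

allSubsets-complete : (p : Subset n) → p ∈ₗ allSubsets n
allSubsets-complete []          = here refl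
allSubsets-complete (true ∷ p)  = ∈-++⁺ˡ (∈-map⁺ (true ∷_) (allSubsets-complete p))
allSubsets-complete (false ∷ p) = ∈-++⁺ʳ _ (∈-map⁺ (false ∷_) (allSubsets-complete p))

allSubsets-unique : ∀ n → Unique (allSubsets n)
allSubsets-unique zero    = [] ∷ []
allSubsets-unique (suc n) =
  Unique.++⁺ (Unique.map⁺ ∷-injectiveʳ (allSubsets-unique n))
             (Unique.map⁺ ∷-injectiveʳ (allSubsets-unique n))
             disjoint
  where
  disjoint : ∀ {p} → ¬ (p ∈ₗ map (true ∷_) (allSubsets n) × p ∈ₗ map (false ∷_) (allSubsets n))
  disjoint (p∈₁ , p∈₂) with ∈-map⁻ (true ∷_) p∈₁ | ∈-map⁻ (false ∷_) p∈₂
  ... | _ , _ , refl | _ , _ , ()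

⊆∧∣p∣≡∣q∣⇒p≡q : {p q : Subset n} → p ⊆ q → ∣ p ∣ ≡ ∣ q ∣ → p ≡ q
⊆∧∣p∣≡∣q∣⇒p≡q {p = []}        {[]}        _   _ = refl
⊆∧∣p∣≡∣q∣⇒p≡q {p = true ∷ p}  {true ∷ q}  p⊆q e =
  cong (true ∷_) (⊆∧∣p∣≡∣q∣⇒p≡q (drop-∷-⊆ p⊆q) (suc-injective e))
⊆∧∣p∣≡∣q∣⇒p≡q {p = false ∷ p} {false ∷ q} p⊆q e =
  cong (false ∷_) (⊆∧∣p∣≡∣q∣⇒p≡q (drop-∷-⊆ p⊆q) e)
⊆∧∣p∣≡∣q∣⇒p≡q {p = true ∷ p}  {false ∷ q} p⊆q e with () ← p⊆q here
⊆∧∣p∣≡∣q∣⇒p≡q {p = false ∷ p} {true ∷ q}  p⊆q e =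
  contradiction (subst (_≤ ∣ q ∣) e (p⊆q⇒∣p∣≤∣q∣ (drop-∷-⊆ p⊆q))) (<⇒≱ ≤-refl)

⊆∧∣q∣≡1+∣p∣⇒q≡p∪⁅x⁆ : {p q : Subset n} → p ⊆ q → ∣ q ∣ ≡ suc ∣ p ∣ → ∃[ x ] (x ∉ p × q ≡ p ∪ ⁅ x ⁆)
⊆∧∣q∣≡1+∣p∣⇒q≡p∪⁅x⁆ {p = true ∷ p} {true ∷ q} p⊆q e
  with x , x∉p , q≡ ← ⊆∧∣q∣≡1+∣p∣⇒q≡p∪⁅x⁆ (drop-∷-⊆ p⊆q) (suc-injective e)
  = suc x , x∉p ∘ drop-there , cong (true ∷_) q≡
⊆∧∣q∣≡1+∣p∣⇒q≡p∪⁅x⁆ {p = false ∷ p} {false ∷ q} p⊆q e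
  with x , x∉p , q≡ ← ⊆∧∣q∣≡1+∣p∣⇒q≡p∪⁅x⁆ (drop-∷-⊆ p⊆q) e
  = suc x , x∉p ∘ drop-there , cong (false ∷_) q≡
⊆∧∣q∣≡1+∣p∣⇒q≡p∪⁅x⁆ {p = true ∷ p} {false ∷ q} p⊆q e with () ← p⊆q here
⊆∧∣q∣≡1+∣p∣⇒q≡p∪⁅x⁆ {p = false ∷ p} {true ∷ q} p⊆q e =
  zero , (λ ()) , cong (true ∷_) (trans q≡p (sym (∪-identityʳ p)))
  where
  q≡p : q ≡ p
  q≡p = sym (⊆∧∣p∣≡∣q∣⇒p≡q (drop-∷-⊆ p⊆q) (sym (suc-injective e)))

∣p∣≡1+∣p-x∣ : {p : Subset n} {x : Fin n} → x ∈ p → ∣ p ∣ ≡ suc ∣ p - x ∣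
∣p∣≡1+∣p-x∣ {p = true ∷ p}  {zero}  here       = cong (suc ∘ ∣_∣) (sym (p─⊥≡p p))
∣p∣≡1+∣p-x∣ {p = true ∷ p}  {suc x} (there x∈) = cong suc (∣p∣≡1+∣p-x∣ x∈)
∣p∣≡1+∣p-x∣ {p = false ∷ p} {suc x} (there x∈) = ∣p∣≡1+∣p-x∣ x∈

∣p∣<∣q∣⇒∃∈q∉p : {p q : Subset n} → ∣ p ∣ < ∣ q ∣ → ∃[ x ] (x ∈ q × x ∉ p)
∣p∣<∣q∣⇒∃∈q∉p {p = p} {q} ∣p∣<∣q∣ with Fin.any? (λ x → (x ∈? q) ×-dec ¬? (x ∈? p))
... | yes found = found
... | no none   = contradiction (p⊆q⇒∣p∣≤∣q∣ q⊆p) (<⇒≱ ∣p∣<∣q∣)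
  where
  q⊆p : q ⊆ p
  q⊆p {x} x∈q = decidable-stable (x ∈? p) (λ x∉p → none (x , x∈q , x∉p))

enumerate : (p : Subset n) → Fin ∣ p ∣ → Fin n
enumerate (true ∷ p)  zero    = zero
enumerate (true ∷ p)  (suc i) = suc (enumerate p i)
enumerate (false ∷ p) i       = suc (enumerate p i)

enumerate-∈ : (p : Subset n) (i : Fin ∣ p ∣) → enumerate p i ∈ p
enumerate-∈ (true ∷ p)  zero    = here
enumerate-∈ (true ∷ p)  (suc i) = there (enumerate-∈ p i)
enumerate-∈ (false ∷ p) i       = there (enumerate-∈ p i)

enumerate-injective : (p : Subset n) {i j : Fin ∣ p ∣} → enumerate p i ≡ enumerate p j → i ≡ j
enumerate-injective (true ∷ p)  {zero}  {zero}  _ = refl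
enumerate-injective (true ∷ p)  {suc i} {suc j} e =
  cong suc (enumerate-injective p (Fin.suc-injective e))
enumerate-injective (false ∷ p)                 e = enumerate-injective p (Fin.suc-injective e)

restrictSubset : Subset (suc n) → Subset n
restrictSubset p = tabulate (lookup p ∘ inject₁)

∈-restrictSubset⁻ : {p : Subset (suc n)} {i : Fin n} → i ∈ restrictSubset p → inject₁ i ∈ p
∈-restrictSubset⁻ {p = p} {i} i∈ =
  lookup⇒[]= _ p (trans (sym (lookup∘tabulate (lookup p ∘ inject₁) i)) ([]=⇒lookup i∈))

∈-restrictSubset⁺ : {p : Subset (suc n)} {i : Fin n} → inject₁ i ∈ p → i ∈ restrictSubset p
∈-restrictSubset⁺ {p = p} {i} i∈ =
  lookup⇒[]= i _ (trans (lookup∘tabulate (lookup p ∘ inject₁) i) ([]=⇒lookup i∈))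

∣restrictSubset∣-∉ : {p : Subset (suc n)} → fromℕ n ∉ p → ∣ p ∣ ≡ ∣ restrictSubset p ∣
∣restrictSubset∣-∉ {zero}  {false ∷ []} _ = refl
∣restrictSubset∣-∉ {zero}  {true ∷ []}  last∉ = contradiction here last∉
∣restrictSubset∣-∉ {suc n} {true ∷ p}   last∉ = cong suc (∣restrictSubset∣-∉ (last∉ ∘ there))
∣restrictSubset∣-∉ {suc n} {false ∷ p}  last∉ = ∣restrictSubset∣-∉ (last∉ ∘ there)

∣restrictSubset∣-∈ : {p : Subset (suc n)} → fromℕ n ∈ p → ∣ p ∣ ≡ suc ∣ restrictSubset p ∣
∣restrictSubset∣-∈ {zero}  {true ∷ []}  _ = refl
∣restrictSubset∣-∈ {suc n} {true ∷ p}   (there last∈) = cong suc (∣restrictSubset∣-∈ last∈)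
∣restrictSubset∣-∈ {suc n} {false ∷ p}  (there last∈) = ∣restrictSubset∣-∈ last∈

∣p∣≡m⇒enumeration : {m : ℕ} {p : Subset n} → ∣ p ∣ ≡ m →
  Σ[ φ ∈ (Fin m → Fin n) ] (Injective _≡_ _≡_ φ × (∀ i → φ i ∈ p))
∣p∣≡m⇒enumeration {p = p} refl = enumerate p , enumerate-injective p , enumerate-∈ p

Embeds-trans : ∀ {m} {H : Graph m} {T : Graph s} {G : Graph n} → Embeds H T → Embeds T G → Embeds H G
Embeds-trans (ψ , ψ-inj , ψ-adj) (φ , φ-inj , φ-adj) =
  φ ∘ ψ , ψ-inj ∘ φ-inj , λ i j → φ-adj (ψ i) (ψ j) ∘ ψ-adj i j

extend : {A : Set} → (Fin s → A) → A → Fin (suc s) → A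
extend φ u i with view i
... | ‵fromℕ     = u
... | ‵inject₁ j = φ j

extend-injective : {φ : Fin s → Fin n} {u : Fin n} → Injective _≡_ _≡_ φ → (∀ j → φ j ≢ u) →
  Injective _≡_ _≡_ (extend φ u)
extend-injective {φ = φ} {u} φ-inj φ≢u {i} {j} e with view i | view j
... | ‵fromℕ     | ‵fromℕ     = refl
... | ‵fromℕ     | ‵inject₁ b = contradiction (sym e) (φ≢u b)
... | ‵inject₁ a | ‵fromℕ     = contradiction e (φ≢u a)
... | ‵inject₁ a | ‵inject₁ b = cong inject₁ (φ-inj e)

∈-lastNbhd⁺ : (T : Graph (suc s)) {j : Fin s} → adj T (inject₁ j) (fromℕ s) ≡ true → j ∈ lastNbhd T
∈-lastNbhd⁺ {s} T {j} j~last =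
  lookup⇒[]= j _ (trans (lookup∘tabulate (λ i → adj T (inject₁ i) (fromℕ s)) j) j~last)

EdgePreserving : {m : ℕ} → Graph m → Graph n → (Fin m → Fin n) → Set
EdgePreserving H G φ = ∀ i j → adj H i j ≡ true → adj G (φ i) (φ j) ≡ true

extend-edgePreserving : (T : Graph (suc s)) (G : Graph n) {φ : Fin s → Fin n} {u : Fin n} →
  EdgePreserving (restrict T) G φ → (∀ {j} → j ∈ lastNbhd T → adj G (φ j) u ≡ true) →
  EdgePreserving T G (extend φ u)
extend-edgePreserving {s} T G {φ} {u} φ-adj nbhd~u i j i~j with view i | view j
... | ‵fromℕ     | ‵fromℕ     = contradiction (trans (sym i~j) (irrefl T (fromℕ s))) λ ()
... | ‵inject₁ a | ‵fromℕ     = nbhd~u (∈-lastNbhd⁺ T i~j)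
... | ‵fromℕ     | ‵inject₁ b =
  trans (Graph.sym G u (φ b)) (nbhd~u (∈-lastNbhd⁺ T (trans (Graph.sym T _ _) i~j)))
... | ‵inject₁ a | ‵inject₁ b = φ-adj a b i~j

restrictSubset-isClique : (T : Graph (suc s)) {j : ℕ} {K : Subset (suc s)} → IsClique T j K →
  fromℕ s ∉ K → IsClique (restrict T) j (restrictSubset K)
restrictSubset-isClique T (∣K∣≡j , K-adj) last∉K =
  trans (sym (∣restrictSubset∣-∉ last∉K)) ∣K∣≡j ,
  λ x y x∈ y∈ x≢y →
    K-adj _ _ (∈-restrictSubset⁻ x∈) (∈-restrictSubset⁻ y∈) (x≢y ∘ Fin.inject₁-injective)

restrictSubset⊆lastNbhd : (T : Graph (suc s)) {j : ℕ} {K : Subset (suc s)} → IsClique T j K →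
  fromℕ s ∈ K → restrictSubset K ⊆ lastNbhd T
restrictSubset⊆lastNbhd T (_ , K-adj) last∈K x∈ =
  ∈-lastNbhd⁺ T (K-adj _ _ (∈-restrictSubset⁻ x∈) last∈K (Fin.fromℕ≢inject₁ ∘ sym))

⊆-isClique : (G : Graph n) {i j : ℕ} {U W : Subset n} →
  IsClique G j U → W ⊆ U → ∣ W ∣ ≡ i → IsClique G i W
⊆-isClique G (_ , U-adj) W⊆U ∣W∣≡i = ∣W∣≡i , λ x y x∈W y∈W → U-adj x y (W⊆U x∈W) (W⊆U y∈W)

module Peeling {n : ℕ} (k : ℕ) where

  _≟ˢ_ : DecidableEquality (Subset n)
  _≟ˢ_ = ≡-dec Bool._≟_

  open import Data.List.Membership.DecPropositional _≟ˢ_ using () renaming (_∈?_ to _∈ₗ?_)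
  open FunctionUpdate _≟ˢ_

  Extends : List (Subset n) → Subset n → Fin n → Set
  Extends F W v = v ∉ W × W ∪ ⁅ v ⁆ ∈ₗ F

  extends? : ∀ F W v → Dec (Extends F W v)
  extends? F W v = ¬? (v ∈? W) ×-dec (W ∪ ⁅ v ⁆ ∈ₗ? F)

  extensions : List (Subset n) → Subset n → List (Fin n)
  extensions F W = filter (extends? F W) (allFin n)

  extensions-unique : ∀ F W → Unique (extensions F W)
  extensions-unique F W = Unique.filter⁺ _ (Unique.allFin⁺ n)

  ∈-extensions⁺ : ∀ {F W v} → Extends F W v → v ∈ₗ extensions F W
  ∈-extensions⁺ {F} {W} {v} = ∈-filter⁺ (extends? F W) (∈-allFin v)

  ∈-extensions⁻ : ∀ {F W v} → v ∈ₗ extensions F W → Extends F W v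
  ∈-extensions⁻ {F} {W} = proj₂ ∘ ∈-filter⁻ (extends? F W) {xs = allFin n}

  Face : List (Subset n) → Subset n → Set
  Face F W = ∣ W ∣ ≡ k × Any (W ⊆_) F

  face? : ∀ F W → Dec (Face F W)
  face? F W = (∣ W ∣ ≟ℕ k) ×-dec Any.any? (W ⊆?_) F

  Stuck : ℕ → List (Subset n) → Set
  Stuck t F = ∀ {W} → Face F W → t ≤ length (extensions F W)

  module _ {F : List (Subset n)} (F-sizes : All (λ U → ∣ U ∣ ≡ suc k) F) where

    containing≤extensions : ∀ {W Vs} → ∣ W ∣ ≡ k → Unique Vs → Vs ⊆ₗ F → All (W ⊆_) Vs →
      length Vs ≤ length (extensions F W)
    containing≤extensions {W} {Vs} ∣W∣≡k Vs! Vs⊆F W⊆Vs = begin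
      length Vs                                    ≤⟨ Unique∧⊆⇒length≤ _≟ˢ_ Vs! Vs⊆W∪extensions ⟩
      length (map ((W ∪_) ∘ ⁅_⁆) (extensions F W)) ≡⟨ length-map _ (extensions F W) ⟩
      length (extensions F W)                      ∎
      where
      open ≤-Reasoning
      Vs⊆W∪extensions : Vs ⊆ₗ map ((W ∪_) ∘ ⁅_⁆) (extensions F W)
      Vs⊆W∪extensions V∈Vs
        with v , v∉W , refl ← ⊆∧∣q∣≡1+∣p∣⇒q≡p∪⁅x⁆ (All.lookup W⊆Vs V∈Vs)
                                  (trans (All.lookup F-sizes (Vs⊆F V∈Vs)) (cong suc (sym ∣W∣≡k)))
        = ∈-map⁺ ((W ∪_) ∘ ⁅_⁆) (∈-extensions⁺ (v∉W , Vs⊆F V∈Vs))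

  IsAssignment : ℕ → List (Subset n) → (Subset n → Subset n) → Set
  IsAssignment C F f = (∀ {U} → U ∈ₗ F → f U ⊆ U × ∣ f U ∣ ≡ k) × FibresBoundedBy _≟ˢ_ f C F

  empty-isAssignment : ∀ {C F} (f : Subset n → Subset n) → (∀ {U} → U ∉ₗ F) → IsAssignment C F f
  empty-isAssignment f F-empty = (λ U∈F → contradiction U∈F F-empty) , bounded
    where
    bounded : FibresBoundedBy _≟ˢ_ f _ _
    bounded _ []      _ _    _ = z≤n
    bounded _ (_ ∷ _) _ Us⊆F _ = contradiction (Us⊆F (here refl)) F-empty

  delete : Subset n → List (Subset n) → List (Subset n)
  delete U = filter (λ V → ¬? (U ≟ˢ V))

  module _ {t : ℕ} {F : List (Subset n)} (F-sizes : All (λ U → ∣ U ∣ ≡ suc k) F)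
           {U W : Subset n} (U∈F : U ∈ₗ F) (W⊆U : W ⊆ U) (∣W∣≡k : ∣ W ∣ ≡ k)
           (few-extensions : length (extensions F W) < t) where

    isAssignment-[↦] : ∀ {f} → IsAssignment t (delete U F) f → IsAssignment t F (f [ U ↦ W ])
    isAssignment-[↦] {f} (f-faces , f-fibres) = faces , fibres
      where
      g = f [ U ↦ W ]

      faces : ∀ {V} → V ∈ₗ F → g V ⊆ V × ∣ g V ∣ ≡ k
      faces {V} V∈F with U ≟ˢ V
      ... | yes refl = W⊆U , ∣W∣≡k
      ... | no U≢V   = f-faces (∈-filter⁺ _ V∈F U≢V)

      fibres : FibresBoundedBy _≟ˢ_ g t F
      fibres W′ Us Us! Us⊆F g[Us]≡W′ with U ∈ₗ? Us
      ... | yes U∈Us =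
        ≤-trans (containing≤extensions F-sizes ∣W∣≡k Us! Us⊆F W⊆Us) (<⇒≤ few-extensions)
        where
        W≡W′ : W ≡ W′
        W≡W′ = trans (sym ([↦]-updated f U W)) (All.lookup g[Us]≡W′ U∈Us)
        W⊆Us : All (W ⊆_) Us
        W⊆Us = All.tabulate λ {V} V∈Us →
          subst (_⊆ V) (trans (All.lookup g[Us]≡W′ V∈Us) (sym W≡W′)) (proj₁ (faces (Us⊆F V∈Us)))
      ... | no U∉Us = f-fibres W′ Us Us! Us⊆F∖U f[Us]≡W′
        where
        U≢ : ∀ {V} → V ∈ₗ Us → U ≢ V
        U≢ V∈Us refl = U∉Us V∈Us
        Us⊆F∖U : Us ⊆ₗ delete U F
        Us⊆F∖U V∈Us = ∈-filter⁺ _ (Us⊆F V∈Us) (U≢ V∈Us)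
        f[Us]≡W′ : All (λ V → f V ≡ W′) Us
        f[Us]≡W′ = All.tabulate λ V∈Us →
          trans (sym ([↦]-unchanged f W (U≢ V∈Us))) (All.lookup g[Us]≡W′ V∈Us)

  module _ (t : ℕ) {F₀ : List (Subset n)} (F₀-sizes : All (λ U → ∣ U ∣ ≡ suc k) F₀)
           (never-stuck : ∀ {F} → F ⊆ₗ F₀ → Stuck t F → ∀ {U} → U ∉ₗ F) where

    peelable-or-stuck : ∀ F → (∃[ W ] (Face F W × length (extensions F W) < t)) ⊎ Stuck t F
    peelable-or-stuck F
      with Any.any? (λ W → face? F W ×-dec (suc (length (extensions F W)) ≤? t)) (allSubsets n)
    ... | yes found = inj₁ (let W , _ , W-ok = find found in W , W-ok)
    ... | no none   =
      inj₂ λ {W} W-face → ≮⇒≥ (λ few → none (lose (allSubsets-complete W) (W-face , few)))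

    assignment : ∀ fuel F → length F < fuel → F ⊆ₗ F₀ → ∃[ f ] IsAssignment t F f
    assignment (suc fuel) F ∣F∣<1+fuel F⊆F₀ with peelable-or-stuck F
    ... | inj₂ stuck = id , empty-isAssignment id (never-stuck F⊆F₀ stuck)
    ... | inj₁ (W , (∣W∣≡k , W⊆some-U) , few) = peel (find W⊆some-U)
      where
      F-sizes : All (λ U → ∣ U ∣ ≡ suc k) F
      F-sizes = All.tabulate (All.lookup F₀-sizes ∘ F⊆F₀)
      peel : ∃[ U ] (U ∈ₗ F × W ⊆ U) → ∃[ f ] IsAssignment t F f
      peel (U , U∈F , W⊆U) =
        let f , f-ok = assignment fuel (delete U F) shorter (F⊆F₀ ∘ proj₁ ∘ ∈-filter⁻ _ {xs = F})
        in f [ U ↦ W ] , isAssignment-[↦] F-sizes U∈F W⊆U ∣W∣≡k few f-ok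
        where
        shorter : length (delete U F) < fuel
        shorter =
          <-≤-trans (filter-notAll _ F (Any.map (λ U≡V U≢V → U≢V U≡V) U∈F)) (s≤s⁻¹ ∣F∣<1+fuel)

    boundedAssignment : ∃[ f ] IsAssignment t F₀ f
    boundedAssignment = assignment (suc (length F₀)) F₀ ≤-refl id

module KTreeEmbedding {n : ℕ} (G : Graph n) (k t : ℕ) {F : List (Subset n)}
  (F-cliques : All (IsClique G (suc k)) F) (F-stuck : Peeling.Stuck k t F) where
  open Peeling {n} k

  face-minus : ∀ {U x} → U ∈ₗ F → x ∈ U → Face F (U - x)
  face-minus {U} {x} U∈F x∈U =
    suc-injective (trans (sym (∣p∣≡1+∣p-x∣ x∈U)) (proj₁ (All.lookup F-cliques U∈F))) ,
    lose U∈F (p─q⊆p U ⁅ x ⁆)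

  member-adj : ∀ {U x y} → U ∈ₗ F → x ∈ U → y ∈ U → x ≢ y → adj G x y ≡ true
  member-adj U∈F = proj₂ (All.lookup F-cliques U∈F) _ _

  fresh-extension : ∀ {W} → Face F W → (used : List (Fin n)) → length used < t →
    ∃[ u ] (Extends F W u × u ∉ₗ used)
  fresh-extension {W} W-face used few-used
    with u , u∈ , u∉used ← Unique∧longer⇒∃∉ Fin._≟_ (extensions-unique F W)
                                             (<-≤-trans few-used (F-stuck W-face))
    = u , ∈-extensions⁻ u∈ , u∉used

  CliquesCovered : ∀ {s} → Graph s → (Fin s → Fin n) → Set
  CliquesCovered T φ = ∀ {K} → IsClique T k K → ∃[ W ] (Face F W × (∀ {i} → i ∈ K → φ i ∈ W))

  CoveringEmbedding : ∀ {s} → Graph s → Set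
  CoveringEmbedding T = Σ[ e ∈ Embeds T G ] CliquesCovered T (proj₁ e)

  kVertex-coveringEmbedding : ∀ {U₀} → U₀ ∈ₗ F → (T : Graph k) → CoveringEmbedding T
  kVertex-coveringEmbedding {U₀} U₀∈F T = (φ , φ-inj , φ-adj) , λ _ → W₀ , W₀-face , λ {i} _ → φ∈W₀ i
    where
    U₀-enum = ∣p∣≡m⇒enumeration {p = U₀} (proj₁ (All.lookup F-cliques U₀∈F))
    x : Fin n
    x = proj₁ U₀-enum zero
    x∈U₀ : x ∈ U₀
    x∈U₀ = proj₂ (proj₂ U₀-enum) zero
    W₀ = U₀ - x
    W₀-face : Face F W₀
    W₀-face = face-minus U₀∈F x∈U₀
    φ-enum = ∣p∣≡m⇒enumeration {p = W₀} (proj₁ W₀-face)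
    φ = proj₁ φ-enum
    φ-inj = proj₁ (proj₂ φ-enum)
    φ∈W₀ = proj₂ (proj₂ φ-enum)
    φ-adj : EdgePreserving T G φ
    φ-adj i j i~j = member-adj U₀∈F (p─q⊆p U₀ ⁅ x ⁆ (φ∈W₀ i)) (p─q⊆p U₀ ⁅ x ⁆ (φ∈W₀ j)) φi≢φj
      where
      φi≢φj : φ i ≢ φ j
      φi≢φj φi≡φj with refl ← φ-inj {i} {j} φi≡φj = contradiction (trans (sym i~j) (irrefl T i)) λ ()

  module _ {s} (T : Graph (suc s)) (nbhd-clique : IsClique (restrict T) k (lastNbhd T))
           {φ : Fin s → Fin n} (φ-inj : Injective _≡_ _≡_ φ) (φ-adj : EdgePreserving (restrict T) G φ)
           (φ-covered : CliquesCovered (restrict T) φ)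
           {W₀ : Subset n} (nbhd→W₀ : ∀ {j} → j ∈ lastNbhd T → φ j ∈ W₀)
           {u : Fin n} (W₀+u∈F : W₀ ∪ ⁅ u ⁆ ∈ₗ F) (φ≢u : ∀ j → φ j ≢ u) where

    private
      U = W₀ ∪ ⁅ u ⁆
      W₀⊆U : W₀ ⊆ U
      W₀⊆U = p⊆p∪q ⁅ u ⁆
      u∈U : u ∈ U
      u∈U = q⊆p∪q W₀ ⁅ u ⁆ (x∈⁅x⁆ u)

    extend-coveringEmbedding : CoveringEmbedding T
    extend-coveringEmbedding =
      (extend φ u , extend-injective φ-inj φ≢u , extend-edgePreserving T G φ-adj nbhd~u) , covered
      where
      nbhd~u : ∀ {j} → j ∈ lastNbhd T → adj G (φ j) u ≡ true
      nbhd~u {j} j∈nbhd = member-adj W₀+u∈F (W₀⊆U (nbhd→W₀ j∈nbhd)) u∈U (φ≢u j)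

      covered : CliquesCovered T (extend φ u)
      covered {K} K-clique with fromℕ s ∈? K
      ... | no last∉K = W , W-face , K→W
        where
        old = φ-covered (restrictSubset-isClique T K-clique last∉K)
        W = proj₁ old
        W-face = proj₁ (proj₂ old)
        K→W : ∀ {i} → i ∈ K → extend φ u i ∈ W
        K→W {i} i∈K with view i
        ... | ‵fromℕ     = contradiction i∈K last∉K
        ... | ‵inject₁ _ = proj₂ (proj₂ old) (∈-restrictSubset⁺ i∈K)
      -- A k-clique through the new vertex misses some y of the k-clique lastNbhd T,
      -- so its image avoids φ y and lies in the face U - φ y.
      ... | yes last∈K = U - φ y , face-minus W₀+u∈F φy∈U , K→U-φy
        where
        ∣K∖last∣<∣nbhd∣ : ∣ restrictSubset K ∣ < ∣ lastNbhd T ∣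
        ∣K∖last∣<∣nbhd∣ = ≤-reflexive (trans (sym (∣restrictSubset∣-∈ last∈K))
                                            (trans (proj₁ K-clique) (sym (proj₁ nbhd-clique))))
        missed = ∣p∣<∣q∣⇒∃∈q∉p ∣K∖last∣<∣nbhd∣
        y = proj₁ missed
        φy∈U : φ y ∈ U
        φy∈U = W₀⊆U (nbhd→W₀ (proj₁ (proj₂ missed)))
        K→U-φy : ∀ {i} → i ∈ K → extend φ u i ∈ U - φ y
        K→U-φy {i} i∈K with view i
        ... | ‵fromℕ     = x∈p∧x≢y⇒x∈p-y u∈U (φ≢u y ∘ sym)
        ... | ‵inject₁ j =
          x∈p∧x≢y⇒x∈p-y (W₀⊆U (nbhd→W₀ (restrictSubset⊆lastNbhd T K-clique last∈K j∈)))
                        (λ φj≡φy → proj₂ (proj₂ missed) (subst (_∈ restrictSubset K) (φ-inj φj≡φy) j∈))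
          where
          j∈ = ∈-restrictSubset⁺ i∈K

  kTree-coveringEmbedding : ∀ {U₀} → U₀ ∈ₗ F → ∀ {s} {T : Graph s} → IsKTree k T → s ≤ t →
    CoveringEmbedding T
  kTree-coveringEmbedding U₀∈F (base T _) _ = kVertex-coveringEmbedding U₀∈F T
  kTree-coveringEmbedding U₀∈F {suc s} (step T T⁻-kTree nbhd-clique) 1+s≤t
    with (φ , φ-inj , φ-adj) , φ-covered
           ← kTree-coveringEmbedding U₀∈F T⁻-kTree (≤-trans (n≤1+n s) 1+s≤t)
    with W₀ , W₀-face , nbhd→W₀ ← φ-covered nbhd-clique
    with u , (_ , W₀+u∈F) , u∉φ
           ← fresh-extension W₀-face (List.tabulate φ) (subst (_< t) (sym (length-tabulate φ)) 1+s≤t)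
    = extend-coveringEmbedding T nbhd-clique φ-inj φ-adj φ-covered nbhd→W₀ W₀+u∈F
        (λ j φj≡u → u∉φ (subst (_∈ₗ List.tabulate φ) φj≡u (∈-tabulate⁺ j)))

module _ {n : ℕ} (G : Graph n) (k : ℕ) where
  open Peeling {n} k

  cliques : ℕ → List (Subset n)
  cliques j = filter (isClique? G j) (allSubsets n)

  ∈-cliques⁺ : ∀ {j U} → IsClique G j U → U ∈ₗ cliques j
  ∈-cliques⁺ {j} {U} = ∈-filter⁺ (isClique? G j) (allSubsets-complete U)

  ∈-cliques⁻ : ∀ {j U} → U ∈ₗ cliques j → IsClique G j U
  ∈-cliques⁻ {j} = proj₂ ∘ ∈-filter⁻ (isClique? G j) {xs = allSubsets n}

  map-proj₁⊆cliques : ∀ {j} (Us : List (Σ[ U ∈ Subset n ] IsClique G j U)) →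
    map proj₁ Us ⊆ₗ cliques j
  map-proj₁⊆cliques Us U∈ with (_ , U-clique) , _ , refl ← ∈-map⁻ proj₁ U∈ = ∈-cliques⁺ U-clique

  cliques-unique : ∀ j → Unique (cliques j)
  cliques-unique j = Unique.filter⁺ (isClique? G j) (allSubsets-unique n)

  kTreeFree⇒assignment : ∀ {t} {T : Graph t} → IsKTree k T → Free T G →
    ∃[ f ] IsAssignment t (cliques (suc k)) f
  kTreeFree⇒assignment {t} T-kTree T-free =
    boundedAssignment t (All.tabulate (proj₁ ∘ ∈-cliques⁻)) never-stuck
    where
    never-stuck : ∀ {F} → F ⊆ₗ cliques (suc k) → Stuck t F → ∀ {U} → U ∉ₗ F
    never-stuck F⊆cliques F-stuck U∈F = T-free (proj₁ (kTree-coveringEmbedding U∈F T-kTree ≤-refl))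
      where open KTreeEmbedding G k t (All.tabulate (∈-cliques⁻ ∘ F⊆cliques)) F-stuck

  CliqueAssignment : ℕ → Set
  CliqueAssignment C =
    Σ[ f ∈ ((U : Subset n) → IsClique G (suc k) U → Subset n) ]
      ((∀ U (p : IsClique G (suc k) U) → IsClique G k (f U p) × f U p ⊆ U) ×
       (∀ (W : Subset n) (Us : List (Σ[ U ∈ Subset n ] IsClique G (suc k) U)) →
          Unique (map proj₁ Us) → All (λ Up → f (proj₁ Up) (proj₂ Up) ≡ W) Us → length Us ≤ C))

  assignment⇒cliqueAssignment : ∀ {C f} → IsAssignment C (cliques (suc k)) f → CliqueAssignment C
  assignment⇒cliqueAssignment {C} {f} (faces , fibres) =
    (λ U _ → f U) ,
    (λ U U-clique → let f[U]⊆U , ∣f[U]∣≡k = faces (∈-cliques⁺ U-clique) in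
                    ⊆-isClique G U-clique f[U]⊆U ∣f[U]∣≡k , f[U]⊆U) ,
    λ W Us Us! f[Us]≡W → subst (_≤ C) (length-map proj₁ Us)
      (fibres W (map proj₁ Us) Us! (map-proj₁⊆cliques Us) (All.map⁺ f[Us]≡W))

  assignment⇒cliqueCount : ∀ {C f} → IsAssignment C (cliques (suc k)) f →
    numCliques G (suc k) ≤ C * numCliques G k
  assignment⇒cliqueCount {C} {f} (faces , fibres) =
    length≤fibreBound*length _≟ˢ_ f C (cliques k) (cliques-unique (suc k))
      (All.tabulate λ U∈ → let f[U]⊆U , ∣f[U]∣≡k = faces U∈ in
                           ∈-cliques⁺ (⊆-isClique G (∈-cliques⁻ U∈) f[U]⊆U ∣f[U]∣≡k))
      fibres

lemma3p1 : (k : ℕ) → 1 ≤ k → ∀ {m} (H : Graph m) → SubgraphOfKTree k H →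
    (Σ[ C ∈ ℕ ] (∀ {n} (G : Graph n) → Free H G →
       Σ[ f ∈ ((U : Subset n) → IsClique G (suc k) U → Subset n) ]
         ((∀ U (p : IsClique G (suc k) U) → IsClique G k (f U p) × f U p ⊆ U) ×
          (∀ (W : Subset n) (Us : List (Σ[ U ∈ Subset n ] IsClique G (suc k) U)) →
             Unique (map proj₁ Us) →
             All (λ Up → f (proj₁ Up) (proj₂ Up) ≡ W) Us →
             length Us ≤ C))))
    ×
    (Σ[ C ∈ ℕ ] Σ[ N ∈ ℕ ] (∀ n → N ≤ n → ∀ a b →
       IsEx n (suc k) H a → IsEx n k H b → a ≤ C * b))
lemma3p1 k _ H (t , T , T-kTree , H↪T) =
  (t , λ G H-free → assignment⇒cliqueAssignment G k (proj₂ (assignment G H-free))) ,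
  (t , 0 , ex-bound)
  where
  assignment : ∀ {n} (G : Graph n) → Free H G →
    ∃[ f ] Peeling.IsAssignment k t (cliques G k (suc k)) f
  assignment G H-free =
    kTreeFree⇒assignment G k T-kTree (H-free ∘ Embeds-trans {H = H} {T = T} {G = G} H↪T)

  ex-bound : ∀ n → 0 ≤ n → ∀ a b → IsEx n (suc k) H a → IsEx n k H b → a ≤ t * b
  ex-bound n _ a b ((G , G-free , refl) , _) (_ , b-max) =
    ≤-trans (assignment⇒cliqueCount G k (proj₂ (assignment G G-free))) (*-monoʳ-≤ t (b-max G G-free))
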